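{- There is no number $\mu$ such that $\mu\langle n,m\rangle$ is defined and $\mathcal M(\mu\langle n,m\rangle)$ holds for all $n,m$, and such that for all $n$, $\mathcal M(n)\leftrightarrow\exists m\,\mathcal T(\mu\langle n,m\rangle)$.
   Context: Work in Heyting arithmetic extended by unary predicates $\mathcal M$ ("Meaningful condition") and $\mathcal T$ ("True condition"). $\langle\cdot,\cdot\rangle$ is Cantor pairing; $en$ denotes Kleene application of the $e$-th partial recursive function to $n$, $en\!\downarrow$ that it is defined, and $\Lambda m.\tau(m)$ an index of $m\mapsto\tau(m)$. $\Xi(f,g)$ is a fixed primitive recursive injective coding of pairs. Axioms: (X1) $\forall f,g\,[\mathcal M(\Xi(f,g))\to(\mathcal T(\Xi(f,g))\leftrightarrow\forall n(fn\!\downarrow\wedge\mathcal T(fn)\to gn\!\downarrow\wedge\mathcal T(gn)))]$; (X2) $\forall f,g\,[(\forall n(fn\!\downarrow\to\mathcal M(fn)))\wedge(\forall n(fn\!\downarrow\wedge gn\!\downarrow\wedge\mathcal T(fn)\to\mathcal M(gn)))\to\mathcal M(\Xi(f,g))]$. There is a condition $\bot$ with $\mathcal M(\bot)$ and $\neg\mathcal T(\bot)$. -}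

module Defs where

open import Data.Nat using (ℕ; zero; suc; _+_; _≤_)
open import Data.Product using (Σ; _×_; _,_)
open import Relation.Binary.PropositionalEquality using (_≡_)
open import Relation.Nullary using (¬_)

tri : ℕ → ℕ
tri zero    = zero
tri (suc s) = suc s + tri s

⟨_,_⟩ : ℕ → ℕ → ℕ
⟨ a , b ⟩ = tri (a + b) + b

-- Inverse, enumerating the diagonals (s,0),(s-1,1),...,(0,s).
unpair : ℕ → ℕ × ℕ
unpair zero = 0 , 0
unpair (suc n) with unpair n
... | zero  , b = suc b , 0
... | suc a , b = a , suc b

-- A concrete (acceptable) numbering of the unary partial recursive
-- functions.  An index e is read as  unpair e = (tag , r):
--   tag 0 : x ↦ 0              tag 1 : x ↦ x+1         tag 2 : x ↦ x
--   tag 3 : ⟨a,b⟩ ↦ a          tag 4 : ⟨a,b⟩ ↦ b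
--   tag 5 : with unpair r = (f,g),  x ↦ f(g x)           (composition)
--   tag 6 : with unpair r = (f,g),  x ↦ ⟨f x , g x⟩      (pairing)
--   tag 7 : with unpair r = (f,g),  h⟨x,0⟩ = f x,
--           h⟨x,y+1⟩ = g⟨⟨x,y⟩, h⟨x,y⟩⟩                 (primitive recursion)
--   tag ≥ 8 : x ↦ least y with r⟨x,y⟩ = 0, all earlier values defined
--                                                        (minimisation)
-- Kleene application: e · n ⇓ v  means "φ_e(n) is defined with value v".

infix 4 _·_⇓_

data _·_⇓_ : ℕ → ℕ → ℕ → Set where
  zer  : ∀ {e r x} → unpair e ≡ (0 , r) → e · x ⇓ 0
  sucE : ∀ {e r x} → unpair e ≡ (1 , r) → e · x ⇓ suc x
  idE  : ∀ {e r x} → unpair e ≡ (2 , r) → e · x ⇓ x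
  fstE : ∀ {e r x a b} → unpair e ≡ (3 , r) → unpair x ≡ (a , b) → e · x ⇓ a
  sndE : ∀ {e r x a b} → unpair e ≡ (4 , r) → unpair x ≡ (a , b) → e · x ⇓ b
  compE : ∀ {e r f g x y z} → unpair e ≡ (5 , r) → unpair r ≡ (f , g) →
          g · x ⇓ y → f · y ⇓ z → e · x ⇓ z
  pairE : ∀ {e r f g x y z} → unpair e ≡ (6 , r) → unpair r ≡ (f , g) →
          f · x ⇓ y → g · x ⇓ z → e · x ⇓ ⟨ y , z ⟩
  prim0 : ∀ {e r f g p x v} → unpair e ≡ (7 , r) → unpair r ≡ (f , g) →
          unpair p ≡ (x , 0) → f · x ⇓ v → e · p ⇓ v
  primS : ∀ {e r f g p x y w v} → unpair e ≡ (7 , r) → unpair r ≡ (f , g) →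
          unpair p ≡ (x , suc y) → e · ⟨ x , y ⟩ ⇓ w →
          g · ⟨ ⟨ x , y ⟩ , w ⟩ ⇓ v → e · p ⇓ v
  minE : ∀ {e t r x y} → unpair e ≡ (8 + t , r) →
         r · ⟨ x , y ⟩ ⇓ 0 →
         (∀ z → suc z ≤ y → Σ ℕ λ k → r · ⟨ x , z ⟩ ⇓ suc k) →
         e · x ⇓ y

Def∧ : (ℕ → Set) → ℕ → ℕ → Set
Def∧ P e n = Σ ℕ λ v → (e · n ⇓ v) × P v

Ξ : ℕ → ℕ → ℕ
Ξ f g = ⟨ f , g ⟩

_⇔_ : Set → Set → Set
A ⇔ B = (A → B) × (B → A)

-- Axioms (X1), (X2) for predicates M ("meaningful"), T ("true").
X1 : (ℕ → Set) → (ℕ → Set) → Set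
X1 M T = ∀ f g → M (Ξ f g) →
  (T (Ξ f g) ⇔ (∀ n → Def∧ T f n → Def∧ T g n))

X2 : (ℕ → Set) → (ℕ → Set) → Set
X2 M T = ∀ f g →
  (∀ n v → f · n ⇓ v → M v) →
  (∀ n v w → f · n ⇓ v → g · n ⇓ w → T v → M w) →
  M (Ξ f g)

HasFalsum : (ℕ → Set) → (ℕ → Set) → Set
HasFalsum M T = Σ ℕ λ b → M b × ¬ T b

-- If μ enumerated witnesses of meaningfulness, Kleene's recursion theorem would give a
-- condition Q = Ξ (m ↦ μ⟨Q,m⟩) (const ¬Q), where ¬Q = Ξ (const Q) (const ⊥). By (X2) Q is
-- meaningful: each μ⟨Q,m⟩ is, and a true one witnesses that Q, hence ¬Q, is meaningful.
-- So some μ⟨Q,m⟩ is true, and (X1) makes Q a liar sentence: T Q ↔ T ¬Q ↔ ¬ T Q.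
module Submission where

open import Defs
open import Data.Nat using (ℕ; zero; suc; _+_; _≤_)
open import Data.Nat.Properties using (+-suc; +-identityʳ; +-comm; suc-injective; <-cmp)
open import Data.Product using (Σ; _×_; _,_; proj₁; proj₂)
open import Data.Sum using (_⊎_; inj₁; inj₂)
open import Data.Empty using (⊥-elim)
open import Relation.Binary using (tri<; tri≈; tri>)
open import Relation.Binary.PropositionalEquality
  using (_≡_; refl; sym; trans; cong; cong₂; subst)
open import Relation.Nullary using (¬_)

pair-suc : ∀ a b → ⟨ a , suc b ⟩ ≡ suc ⟨ suc a , b ⟩
pair-suc a b rewrite +-suc a b = +-suc (tri (suc (a + b))) b

pair-zero : ∀ b → ⟨ suc b , 0 ⟩ ≡ suc ⟨ 0 , b ⟩
pair-zero b rewrite +-identityʳ b | +-identityʳ (b + tri b) = cong suc (+-comm b (tri b))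

unpair-suc-zero : ∀ n {b} → unpair n ≡ (0 , b) → unpair (suc n) ≡ (suc b , 0)
unpair-suc-zero _ eq rewrite eq = refl

unpair-suc-suc : ∀ n {a b} → unpair n ≡ (suc a , b) → unpair (suc n) ≡ (a , suc b)
unpair-suc-suc _ eq rewrite eq = refl

unpair-⟨,⟩ : ∀ a b → unpair ⟨ a , b ⟩ ≡ (a , b)
unpair-⟨,⟩ a b = go (a + b) a b refl
  where
  go : ∀ s a b → a + b ≡ s → unpair ⟨ a , b ⟩ ≡ (a , b)
  go s       a       (suc b) eq =
    trans (cong unpair (pair-suc a b)) (unpair-suc-suc ⟨ suc a , b ⟩ (go s (suc a) b (trans (sym (+-suc a b)) eq)))
  go (suc s) (suc a) zero    eq =
    trans (cong unpair (pair-zero a))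
          (unpair-suc-zero ⟨ 0 , a ⟩ (go s 0 a (trans (sym (+-identityʳ a)) (suc-injective eq))))
  go _       zero    zero    _  = refl
  go zero    (suc a) zero    ()

RecursionShape : ℕ → ℕ → ℕ → ℕ → ℕ → Set
RecursionShape e f g p v =
  (Σ ℕ λ x → unpair p ≡ (x , 0) × f · x ⇓ v) ⊎
  (Σ ℕ λ x → Σ ℕ λ y → Σ ℕ λ w →
     unpair p ≡ (x , suc y) × e · ⟨ x , y ⟩ ⇓ w × g · ⟨ ⟨ x , y ⟩ , w ⟩ ⇓ v)

-- Inversion of e · x ⇓ v once unpair e ≡ (tag , r) is known; as the tag is an index,
-- unification discards the rules of all other tags.
Shape : ℕ → ℕ → ℕ → ℕ → ℕ → Set
Shape e 0 r x v = v ≡ 0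
Shape e 1 r x v = v ≡ suc x
Shape e 2 r x v = v ≡ x
Shape e 3 r x v = Σ ℕ λ b → unpair x ≡ (v , b)
Shape e 4 r x v = Σ ℕ λ a → unpair x ≡ (a , v)
Shape e 5 r x v = Σ ℕ λ f → Σ ℕ λ g → Σ ℕ λ y →
  unpair r ≡ (f , g) × g · x ⇓ y × f · y ⇓ v
Shape e 6 r x v = Σ ℕ λ f → Σ ℕ λ g → Σ ℕ λ y → Σ ℕ λ z →
  unpair r ≡ (f , g) × f · x ⇓ y × g · x ⇓ z × v ≡ ⟨ y , z ⟩
Shape e 7 r x v = Σ ℕ λ f → Σ ℕ λ g → unpair r ≡ (f , g) × RecursionShape e f g x v
Shape e (suc (suc (suc (suc (suc (suc (suc (suc _)))))))) r x v =
  r · ⟨ x , v ⟩ ⇓ 0 × (∀ z → suc z ≤ v → Σ ℕ λ k → r · ⟨ x , z ⟩ ⇓ suc k)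

⇓-shape : ∀ {e t r x v} → unpair e ≡ (t , r) → e · x ⇓ v → Shape e t r x v
⇓-shape eq (zer p) with trans (sym eq) p
... | refl = refl
⇓-shape eq (sucE p) with trans (sym eq) p
... | refl = refl
⇓-shape eq (idE p) with trans (sym eq) p
... | refl = refl
⇓-shape eq (fstE p q) with trans (sym eq) p
... | refl = _ , q
⇓-shape eq (sndE p q) with trans (sym eq) p
... | refl = _ , q
⇓-shape eq (compE p q d₁ d₂) with trans (sym eq) p
... | refl = _ , _ , _ , q , d₁ , d₂
⇓-shape eq (pairE p q d₁ d₂) with trans (sym eq) p
... | refl = _ , _ , _ , _ , q , d₁ , d₂ , refl
⇓-shape eq (prim0 p q u d) with trans (sym eq) p
... | refl = _ , _ , q , inj₁ (_ , u , d)
⇓-shape eq (primS p q u d₁ d₂) with trans (sym eq) p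
... | refl = _ , _ , q , inj₂ (_ , _ , _ , u , d₁ , d₂)
⇓-shape eq (minE p d m) with trans (sym eq) p
... | refl = d , m

⇓-deterministic : ∀ {e x v w} → e · x ⇓ v → e · x ⇓ w → v ≡ w
⇓-deterministic (zer p) d = sym (⇓-shape p d)
⇓-deterministic (sucE p) d = sym (⇓-shape p d)
⇓-deterministic (idE p) d = sym (⇓-shape p d)
⇓-deterministic (fstE p q) d with ⇓-shape p d
... | _ , q′ = cong proj₁ (trans (sym q) q′)
⇓-deterministic (sndE p q) d with ⇓-shape p d
... | _ , q′ = cong proj₂ (trans (sym q) q′)
⇓-deterministic (compE p q d₁ d₂) d with ⇓-shape p d
... | _ , _ , _ , q′ , d₁′ , d₂′ with trans (sym q) q′
... | refl with ⇓-deterministic d₁ d₁′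
... | refl = ⇓-deterministic d₂ d₂′
⇓-deterministic (pairE p q d₁ d₂) d with ⇓-shape p d
... | _ , _ , _ , _ , q′ , d₁′ , d₂′ , refl with trans (sym q) q′
... | refl = cong₂ ⟨_,_⟩ (⇓-deterministic d₁ d₁′) (⇓-deterministic d₂ d₂′)
⇓-deterministic (prim0 p q u d₁) d with ⇓-shape p d
... | _ , _ , q′ , inj₁ (_ , u′ , d₁′) with trans (sym q) q′ | trans (sym u) u′
... | refl | refl = ⇓-deterministic d₁ d₁′
⇓-deterministic (prim0 p q u d₁) d | _ , _ , _ , inj₂ (_ , _ , _ , u′ , _) with trans (sym u) u′
... | ()
⇓-deterministic (primS p q u d₁ d₂) d with ⇓-shape p d
... | _ , _ , _ , inj₁ (_ , u′ , _) with trans (sym u) u′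
... | ()
⇓-deterministic (primS p q u d₁ d₂) d | _ , _ , q′ , inj₂ (_ , _ , _ , u′ , d₁′ , d₂′)
  with trans (sym q) q′ | trans (sym u) u′
... | refl | refl with ⇓-deterministic d₁ d₁′
... | refl = ⇓-deterministic d₂ d₂′
⇓-deterministic (minE {y = y} p d₀ below) d with ⇓-shape p d
... | d₀′ , below′ with <-cmp y _
... | tri< y<y′ _ _ with ⇓-deterministic d₀ (proj₂ (below′ y y<y′))
...   | ()
⇓-deterministic (minE {y = y} p d₀ below) d | d₀′ , below′ | tri≈ _ y≡y′ _ = y≡y′
⇓-deterministic (minE {y = y} p d₀ below) d | d₀′ , below′ | tri> _ _ y′<y
  with ⇓-deterministic (proj₂ (below _ y′<y)) d₀′
... | ()

Computable : (ℕ → ℕ) → Set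
Computable F = Σ ℕ λ f → ∀ x → f · x ⇓ F x

-- Codes of concrete programs are astronomically large numerals; opacity keeps Agda from computing them.
opaque
  `suc `id `snd : ℕ
  `suc = ⟨ 1 , 0 ⟩
  `id = ⟨ 2 , 0 ⟩
  `snd = ⟨ 4 , 0 ⟩

  `comp `pair `rec : ℕ → ℕ → ℕ
  `comp f g = ⟨ 5 , ⟨ f , g ⟩ ⟩
  `pair f g = ⟨ 6 , ⟨ f , g ⟩ ⟩
  `rec f g = ⟨ 7 , ⟨ f , g ⟩ ⟩

  ·-suc : ∀ {x} → `suc · x ⇓ suc x
  ·-suc = sucE (unpair-⟨,⟩ 1 0)

  ·-id : ∀ {x} → `id · x ⇓ x
  ·-id = idE (unpair-⟨,⟩ 2 0)

  ·-snd : ∀ {x} → `snd · x ⇓ proj₂ (unpair x)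
  ·-snd = sndE (unpair-⟨,⟩ 4 0) refl

  ·-comp : ∀ {f g x y z} → f · y ⇓ z → g · x ⇓ y → `comp f g · x ⇓ z
  ·-comp {f} {g} df dg = compE (unpair-⟨,⟩ 5 ⟨ f , g ⟩) (unpair-⟨,⟩ f g) dg df

  ·-pair : ∀ {f g x y z} → f · x ⇓ y → g · x ⇓ z → `pair f g · x ⇓ ⟨ y , z ⟩
  ·-pair {f} {g} df dg = pairE (unpair-⟨,⟩ 6 ⟨ f , g ⟩) (unpair-⟨,⟩ f g) df dg

  ·-rec : ∀ {f g} (h : ℕ → ℕ → ℕ) → (∀ x → f · x ⇓ h x 0) →
          (∀ x y → g · ⟨ ⟨ x , y ⟩ , h x y ⟩ ⇓ h x (suc y)) →
          ∀ x y → `rec f g · ⟨ x , y ⟩ ⇓ h x y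
  ·-rec {f} {g} h base step x zero =
    prim0 (unpair-⟨,⟩ 7 ⟨ f , g ⟩) (unpair-⟨,⟩ f g) (unpair-⟨,⟩ x 0) (base x)
  ·-rec {f} {g} h base step x (suc y) =
    primS (unpair-⟨,⟩ 7 ⟨ f , g ⟩) (unpair-⟨,⟩ f g) (unpair-⟨,⟩ x (suc y))
          (·-rec h base step x y) (step x y)

opaque
  `const : ℕ → ℕ
  `const zero = ⟨ 0 , 0 ⟩
  `const (suc c) = `comp `suc (`const c)

  `const-suc : ∀ c → `const (suc c) ≡ `comp `suc (`const c)
  `const-suc c = refl

  ·-const : ∀ {c x} → `const c · x ⇓ c
  ·-const {zero} = zer (unpair-⟨,⟩ 0 0)
  ·-const {suc c} = ·-comp ·-suc ·-const

const-computable : ∀ c → Computable (λ _ → c)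
const-computable c = `const c , λ _ → ·-const

-- Kept apart from the block defining `const, so that `const 5 stays opaque here.
opaque
  unfolding `comp

  `comp-computable : ∀ {F G} → Computable F → Computable G →
                     Computable (λ x → `comp (F x) (G x))
  `comp-computable (f , df) (g , dg) =
    `pair (`const 5) (`pair f g) , λ x → ·-pair ·-const (·-pair (df x) (dg x))

  `pair-computable : ∀ {F G} → Computable F → Computable G →
                     Computable (λ x → `pair (F x) (G x))
  `pair-computable (f , df) (g , dg) =
    `pair (`const 6) (`pair f g) , λ x → ·-pair ·-const (·-pair (df x) (dg x))

`const-computable : Computable `const
`const-computable =
  `comp (`rec (`const (`const 0)) step) (`pair (`const 0) `id) ,
  λ c → ·-comp (·-rec (λ _ → `const) (λ _ → ·-const) step⇓ 0 c) (·-pair ·-const ·-id)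
  where
  suc∘snd : Computable (λ p → `comp `suc (proj₂ (unpair p)))
  suc∘snd = `comp-computable (const-computable `suc) (`snd , λ _ → ·-snd)

  step : ℕ
  step = proj₁ suc∘snd

  step⇓ : ∀ x y → step · ⟨ ⟨ x , y ⟩ , `const y ⟩ ⇓ `const (suc y)
  step⇓ x y rewrite `const-suc y = subst (λ p → step · ⟨ ⟨ x , y ⟩ , `const y ⟩ ⇓ `comp `suc (proj₂ p))
                                         (unpair-⟨,⟩ ⟨ x , y ⟩ (`const y)) (proj₂ suc∘snd _)

id-computable : Computable (λ x → x)
id-computable = `id , λ _ → ·-id

⟨,⟩-computable : ∀ {F G} → Computable F → Computable G → Computable (λ x → ⟨ F x , G x ⟩)
⟨,⟩-computable (f , df) (g , dg) = `pair f g , λ x → ·-pair (df x) (dg x)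

∘-computable : ∀ {F G} → Computable F → Computable G → Computable (λ x → F (G x))
∘-computable (f , df) (g , dg) = `comp f g , λ x → ·-comp (df _) (dg x)

-- Kleene's recursion theorem: `comp x (`const x) runs x on its own code, so for a program e
-- computing x ↦ H (`comp x (`const x)), the code d = `comp e (`const e) outputs e · e = H d.
fixpoint : ∀ {H} → Computable H → Σ ℕ λ d → ∀ n → d · n ⇓ H d
fixpoint {H} H-computable = `comp e (`const e) , λ _ → ·-comp (e⇓ e) ·-const
  where
  self-application : Computable (λ x → H (`comp x (`const x)))
  self-application = ∘-computable H-computable (`comp-computable id-computable `const-computable)

  e : ℕ
  e = proj₁ self-application

  e⇓ : ∀ x → e · x ⇓ H (`comp x (`const x))
  e⇓ = proj₂ self-application

module Conditions {M T : ℕ → Set} (x1 : X1 M T) (x2 : X2 M T) where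

  M-Ξ-const : ∀ f c → (∀ n v → f · n ⇓ v → M v) → (∀ n v → f · n ⇓ v → T v → M c) →
              M (Ξ f (`const c))
  M-Ξ-const f c M-f T-f⇒M-c =
    x2 f (`const c) M-f λ n v w fv cw tv → subst M (⇓-deterministic ·-const cw) (T-f⇒M-c n v fv tv)

  T-Ξ-const : ∀ f c → M (Ξ f (`const c)) → T (Ξ f (`const c)) ⇔ (∀ n → Def∧ T f n → T c)
  T-Ξ-const f c m =
    (λ t n fn → output-true (proj₁ (x1 f (`const c) m) t n fn)) ,
    (λ h → proj₂ (x1 f (`const c) m) λ n fn → c , ·-const , h n fn)
    where
    output-true : ∀ {n} → Def∧ T (`const c) n → T c
    output-true (w , cw , tw) = subst T (sym (⇓-deterministic ·-const cw)) tw

¬[P⇔¬P] : ∀ {P : Set} → ¬ (P ⇔ (¬ P))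
¬[P⇔¬P] {P} (to , from) = ¬p (from ¬p)
  where
  ¬p : ¬ P
  ¬p p = to p p

module Liar {M T : ℕ → Set} (x1 : X1 M T) (x2 : X2 M T) (⊥c : ℕ) (M-⊥ : M ⊥c) (¬T-⊥ : ¬ T ⊥c)
            (μ : ℕ) (μ-total : ∀ n m → Def∧ M μ ⟨ n , m ⟩)
            (M⇔μ : ∀ n → M n ⇔ (Σ ℕ λ m → Def∧ T μ ⟨ n , m ⟩)) where

  open Conditions x1 x2

  φ neg H : ℕ → ℕ
  φ x = `comp μ (`pair x `id)
  neg x = Ξ x (`const ⊥c)
  H x = Ξ (φ x) (`const (neg x))

  H-computable : Computable H
  H-computable =
    ⟨,⟩-computable (`comp-computable (const-computable μ) (`pair-computable id-computable (const-computable `id)))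
                   (∘-computable `const-computable (⟨,⟩-computable id-computable (const-computable (`const ⊥c))))

  d : ℕ
  d = proj₁ (fixpoint H-computable)

  Q : ℕ
  Q = H d

  d⇓Q : ∀ n → d · n ⇓ Q
  d⇓Q = proj₂ (fixpoint H-computable)

  φ⇓ : ∀ {m v} → μ · ⟨ Q , m ⟩ ⇓ v → φ d · m ⇓ v
  φ⇓ {m} μv = ·-comp μv (·-pair (d⇓Q m) ·-id)

  φ⇓⁻¹ : ∀ {m v} → φ d · m ⇓ v → μ · ⟨ Q , m ⟩ ⇓ v × M v
  φ⇓⁻¹ {m} φv with μ-total Q m
  ... | w , μw , mw with ⇓-deterministic φv (φ⇓ μw)
  ... | refl = μw , mw

  M-negQ : M Q → M (neg d)
  M-negQ m-Q = M-Ξ-const d ⊥c (λ n _ dv → subst M (⇓-deterministic (d⇓Q n) dv) m-Q) (λ _ _ _ _ → M-⊥)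

  M-Q : M Q
  M-Q = M-Ξ-const (φ d) (neg d) (λ _ _ φv → proj₂ (φ⇓⁻¹ φv))
                  (λ n v φv tv → M-negQ (proj₂ (M⇔μ Q) (n , v , proj₁ (φ⇓⁻¹ φv) , tv)))

  T-negQ⇔¬T-Q : T (neg d) ⇔ (¬ T Q)
  T-negQ⇔¬T-Q =
    (λ t tq → ¬T-⊥ (proj₁ (T-Ξ-const d ⊥c (M-negQ M-Q)) t 0 (Q , d⇓Q 0 , tq))) ,
    (λ ¬tq → proj₂ (T-Ξ-const d ⊥c (M-negQ M-Q)) λ n (v , dv , tv) →
               ⊥-elim (¬tq (subst T (⇓-deterministic dv (d⇓Q n)) tv)))

  T-Q⇒¬T-Q : T Q → ¬ T Q
  T-Q⇒¬T-Q tq with proj₁ (M⇔μ Q) M-Q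
  ... | m , v , μv , tv = proj₁ T-negQ⇔¬T-Q (proj₁ (T-Ξ-const (φ d) (neg d) M-Q) tq m (v , φ⇓ μv , tv))

  T-Q⇔¬T-Q : T Q ⇔ (¬ T Q)
  T-Q⇔¬T-Q = T-Q⇒¬T-Q , λ ¬tq → proj₂ (T-Ξ-const (φ d) (neg d) M-Q) λ _ _ → proj₂ T-negQ⇔¬T-Q ¬tq

theorem13 : (M T : ℕ → Set) → X1 M T → X2 M T → HasFalsum M T →
    ¬ (Σ ℕ λ μ → (∀ n m → Def∧ M μ ⟨ n , m ⟩)
                × (∀ n → M n ⇔ (Σ ℕ λ m → Def∧ T μ ⟨ n , m ⟩)))
theorem13 M T x1 x2 (⊥c , M-⊥ , ¬T-⊥) (μ , μ-total , M⇔μ) = ¬[P⇔¬P] T-Q⇔¬T-Q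
  where
  open Liar x1 x2 ⊥c M-⊥ ¬T-⊥ μ μ-total M⇔μ
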